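{- For every $n\ge0$, $$\#\mathrm{Av}_n([1243],[1324])=\#\mathrm{Av}_n([1243],[1423])=\#\mathrm{Av}_n([1324],[1342])=\#\mathrm{Av}_n([1342],[1423]).$$ Moreover, for $n\ge1$, $\#\mathrm{Av}_n([1324],[1342])=1+\binom{n-1}{2}$.
   Context: For a linear permutation $\pi=\pi_1\ldots\pi_n$ of $[n]$, the cyclic permutation $[\pi]$ is the set of all rotations of $\pi$. A linear permutation $\sigma$ contains $\pi$ if some subsequence of $\sigma$ is order isomorphic to $\pi$ (same relative order). A cyclic permutation $[\sigma]$ contains $[\pi]$ if some rotation of $\sigma$ contains $\pi$; otherwise it avoids $[\pi]$. For a set of cyclic patterns $[\Pi]$, $\mathrm{Av}_n[\Pi]$ denotes the set of cyclic permutations of length $n$ avoiding every pattern in $[\Pi]$. -}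

module Defs where

open import Data.Nat using (ℕ; suc; _<_)
open import Data.List using (List; []; _∷_; length; lookup; drop; take; _++_; applyUpTo)
open import Data.List.Relation.Binary.Permutation.Propositional using (_↭_)
open import Data.List.Relation.Binary.Sublist.Propositional using (_⊆_)
open import Data.List.Relation.Unary.All using (All)
open import Data.List.Relation.Unary.Any using (Any)
open import Data.List.Relation.Unary.AllPairs using (AllPairs)
open import Data.Fin using (Fin; cast)
open import Data.Product using (Σ; _×_; ∃)
open import Function.Bundles using (_⇔_)
open import Relation.Nullary using (¬_)
open import Relation.Binary.PropositionalEquality using (_≡_)

IsPerm : ℕ → List ℕ → Set
IsPerm n σ = σ ↭ applyUpTo suc n

OrdIso : List ℕ → List ℕ → Set
OrdIso τ π = Σ (length τ ≡ length π) λ eq →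
  ∀ (i j : Fin (length τ)) →
    (lookup τ i < lookup τ j) ⇔ (lookup π (cast eq i) < lookup π (cast eq j))

Contains : List ℕ → List ℕ → Set
Contains σ π = ∃ λ τ → (τ ⊆ σ) × OrdIso τ π

-- Rotation by r: σ_{r+1} … σ_n σ_1 … σ_r  (r ≥ length gives σ back).
rotate : ℕ → List ℕ → List ℕ
rotate r σ = drop r σ ++ take r σ

CycContains : List ℕ → List ℕ → Set
CycContains σ π = ∃ λ r → Contains (rotate r σ) π

Avoids : List (List ℕ) → List ℕ → Set
Avoids Π σ = All (λ π → ¬ CycContains σ π) Π

RotEquiv : List ℕ → List ℕ → Set
RotEquiv σ σ' = ∃ λ r → rotate r σ ≡ σ'

-- #Av_n[Π] = k : there is a list of k linear permutations of [n] avoiding [Π],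
-- pairwise in distinct rotation classes, such that every avoiding permutation
-- of [n] is a rotation of one of them (i.e. k = number of cyclic classes).
AvCount : List (List ℕ) → ℕ → ℕ → Set
AvCount Π n k = Σ (List (List ℕ)) λ L →
  (length L ≡ k)
  × All (λ σ → IsPerm n σ × Avoids Π σ) L
  × AllPairs (λ σ σ' → ¬ RotEquiv σ σ') L
  × (∀ σ → IsPerm n σ → Avoids Π σ → Any (RotEquiv σ) L)

p1243 p1324 p1423 p1342 : List ℕ
p1243 = 1 ∷ 2 ∷ 4 ∷ 3 ∷ []
p1324 = 1 ∷ 3 ∷ 2 ∷ 4 ∷ []
p1423 = 1 ∷ 4 ∷ 2 ∷ 3 ∷ []
p1342 = 1 ∷ 3 ∷ 4 ∷ 2 ∷ []

-- Rotating the entry 1 to the front identifies a cyclic permutation of [n] avoiding [1324] and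
-- [1342] with a permutation τ of {2,…,n} avoiding 213, 231 and 4132: a 213 or 231 of τ becomes a
-- 1324 or 1342 after the leading 1, and 4132 is itself a rotation of 1324.  Avoiding 213 and 231
-- forces τ to start with its minimum or its maximum; after the minimum the same holds for the
-- rest, while after the maximum the rest must also avoid 132, which leaves m choices for m entries.
-- The count g satisfies g(m+2) = g(m+1) + (m+1), whence g(m) = 1 + C(m,2).  Reversal and
-- complementation act on cyclic permutations and carry the pair {[1324],[1342]} to
-- {[1243],[1423]} and {[1342],[1423]}; reversing the latter gives {[1243],[1324]}.
{-# OPTIONS --safe #-}
module Submission where

open import Defs
open import Data.Nat using (ℕ; zero; suc; _+_; _∸_; _<_; _≤_; _≥_; s≤s; z<s; _<ᵇ_; _≟_)
open import Data.Nat.Properties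
open import Data.Nat.Combinatorics using (_C_; nC1≡n; nCk+nC[k+1]≡[n+1]C[k+1])
open import Data.Fin using (Fin; zero; suc; cast; #_)
open import Data.Bool using (T)
open import Data.List using (List; []; _∷_; [_]; _++_; length; lookup; drop; take; map; reverse; applyUpTo)
open import Data.List.Properties
  using ( length-map; length-++; ++-identityʳ; ∷-injectiveˡ; ∷-injectiveʳ; take++drop≡id; take-[]; drop-[]
        ; drop-map; take-map; map-++; map-∘; reverse-involutive; reverse-++ )
open import Data.List.Membership.Propositional using (_∈_)
open import Data.List.Membership.Propositional.Properties
  using (∈-lookup; ∈-++⁺ˡ; ∈-++⁺ʳ; ∈-map⁺; ∈-map⁻; ∈-∃++)
open import Data.List.Relation.Binary.Sublist.Propositional using (_⊆_; []; _∷_; _∷ʳ_; from∈; ⊆-trans)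
import Data.List.Relation.Binary.Sublist.Propositional.Properties as Sublist
open import Data.List.Relation.Binary.Permutation.Propositional
  using (_↭_; ↭-refl; ↭-prep; ↭-swap; ↭-trans; ↭-sym)
open import Data.List.Relation.Binary.Permutation.Propositional.Properties as Permutation
  using (All-resp-↭; ∈-resp-↭; ∷↭∷ʳ; drop-∷; drop-mid; ++-comm; ↭-empty-inv; ↭-singleton-inv)
open import Data.List.Relation.Unary.All as All using (All; []; _∷_)
import Data.List.Relation.Unary.All.Properties as Allₚ
open import Data.List.Relation.Unary.Any as Any using (Any; here; there)
import Data.List.Relation.Unary.Any.Properties as Anyₚ
open import Data.List.Relation.Unary.AllPairs using (AllPairs; []; _∷_)
import Data.List.Relation.Unary.AllPairs.Properties as AllPairsₚ
open import Data.List.Relation.Unary.Unique.Propositional using (Unique)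
import Data.List.Relation.Unary.Unique.Propositional.Properties as Unique
open import Data.Product using (Σ; _×_; _,_; proj₁; proj₂; ∃; ∃₂)
open import Data.Sum using (_⊎_; inj₁; inj₂)
open import Data.Empty using (⊥-elim)
open import Function using (_∘_)
open import Function.Bundles using (_⇔_; mk⇔; Equivalence)
open import Relation.Nullary using (¬_; yes; no)
open import Relation.Binary.Definitions using (tri<; tri≈; tri>)
open import Relation.Binary.PropositionalEquality
  using (_≡_; _≢_; refl; sym; trans; cong; cong₂; subst; subst₂; module ≡-Reasoning)
open ≡-Reasoning

lookup-map : ∀ {A B : Set} (f : A → B) (xs : List A) (i : Fin (length (map f xs))) →
             lookup (map f xs) i ≡ f (lookup xs (cast (length-map f xs) i))
lookup-map f (x ∷ xs) zero    = refl
lookup-map f (x ∷ xs) (suc i) = lookup-map f xs i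

AllPairs-mapᵖ : ∀ {A : Set} {P : A → Set} {R S : A → A → Set} →
                (∀ {x y} → P x → P y → R x y → S x y) →
                ∀ {xs} → All P xs → AllPairs R xs → AllPairs S xs
AllPairs-mapᵖ f []         []         = []
AllPairs-mapᵖ f (px ∷ pxs) (rx ∷ rxs) =
  All.zipWith (λ (py , r) → f px py r) (pxs , rx) ∷ AllPairs-mapᵖ f pxs rxs

↭-∈-tail : ∀ {x y : ℕ} {t xs} → x ∷ t ↭ xs → y ∈ xs → x ≢ y → y ∈ t
↭-∈-tail x∷t↭ y∈ x≢y with ∈-resp-↭ (↭-sym x∷t↭) y∈
... | here x≡y = ⊥-elim (x≢y (sym x≡y))
... | there y∈t = y∈t

¬[]↭∷ : ∀ {x : ℕ} {xs} → ¬ ([] ↭ x ∷ xs)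
¬[]↭∷ []↭ with ↭-empty-inv (↭-sym []↭)
... | ()

∈-pair⇒⊆ : ∀ {y z : ℕ} {t} → y ∈ t → z ∈ t → y ≢ z → y ∷ z ∷ [] ⊆ t ⊎ z ∷ y ∷ [] ⊆ t
∈-pair⇒⊆ (here refl) (here refl) y≢z = ⊥-elim (y≢z refl)
∈-pair⇒⊆ (here refl) (there z∈) _   = inj₁ (refl ∷ from∈ z∈)
∈-pair⇒⊆ (there y∈) (here refl) _   = inj₂ (refl ∷ from∈ y∈)
∈-pair⇒⊆ {t = w ∷ t} (there y∈) (there z∈) y≢z with ∈-pair⇒⊆ y∈ z∈ y≢z
... | inj₁ p = inj₁ (w ∷ʳ p)
... | inj₂ p = inj₂ (w ∷ʳ p)

module _ {A : Set} where

  ++-⊆-split : ∀ (xs ys : List A) {zs} → zs ⊆ xs ++ ys →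
               ∃₂ λ zs₁ zs₂ → zs ≡ zs₁ ++ zs₂ × zs₁ ⊆ xs × zs₂ ⊆ ys
  ++-⊆-split []       ys {zs} zs⊆ = [] , zs , refl , [] , zs⊆
  ++-⊆-split (x ∷ xs) ys (_ ∷ʳ zs⊆) with ++-⊆-split xs ys zs⊆
  ... | zs₁ , zs₂ , refl , p₁ , p₂ = zs₁ , zs₂ , refl , x ∷ʳ p₁ , p₂
  ++-⊆-split (x ∷ xs) ys (refl ∷ zs⊆) with ++-⊆-split xs ys zs⊆
  ... | zs₁ , zs₂ , refl , p₁ , p₂ = x ∷ zs₁ , zs₂ , refl , refl ∷ p₁ , p₂

  ⊆-++-split : ∀ (xs ys : List A) {zs} → xs ++ ys ⊆ zs →
               ∃₂ λ zs₁ zs₂ → zs ≡ zs₁ ++ zs₂ × xs ⊆ zs₁ × ys ⊆ zs₂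
  ⊆-++-split []       ys {zs} ys⊆ = [] , zs , refl , [] , ys⊆
  ⊆-++-split (x ∷ xs) ys (z ∷ʳ ⊆zs) with ⊆-++-split (x ∷ xs) ys ⊆zs
  ... | zs₁ , zs₂ , refl , p₁ , p₂ = z ∷ zs₁ , zs₂ , refl , z ∷ʳ p₁ , p₂
  ⊆-++-split (x ∷ xs) ys (refl ∷ ⊆zs) with ⊆-++-split xs ys ⊆zs
  ... | zs₁ , zs₂ , refl , p₁ , p₂ = x ∷ zs₁ , zs₂ , refl , refl ∷ p₁ , p₂

⊆-init : ∀ {a b c d : ℕ} {τ} → a ∷ b ∷ c ∷ d ∷ [] ⊆ τ → a ∷ b ∷ c ∷ [] ⊆ τ
⊆-init {d = d} = ⊆-trans (refl ∷ refl ∷ refl ∷ d ∷ʳ [])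

-- Rotations

rotate-++ : ∀ (xs ys : List ℕ) → rotate (length xs) (xs ++ ys) ≡ ys ++ xs
rotate-++ xs ys = cong₂ _++_ (drop-length xs) (take-length xs)
  where
  drop-length : ∀ xs → drop (length xs) (xs ++ ys) ≡ ys
  drop-length []       = refl
  drop-length (_ ∷ xs) = drop-length xs
  take-length : ∀ xs → take (length xs) (xs ++ ys) ≡ xs
  take-length []       = refl
  take-length (x ∷ xs) = cong (x ∷_) (take-length xs)

⊆-++-comm : ∀ xs ys {τ} → τ ⊆ ys ++ xs → ∃ λ s → rotate s τ ⊆ xs ++ ys
⊆-++-comm xs ys τ⊆ with ++-⊆-split ys xs τ⊆
... | τ₁ , τ₂ , refl , p₁ , p₂ =
  length τ₁ , subst (_⊆ xs ++ ys) (sym (rotate-++ τ₁ τ₂)) (Sublist.++⁺ p₂ p₁)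

⊆-rotate⇒rotate-⊆ : ∀ r σ {τ} → τ ⊆ rotate r σ → ∃ λ s → rotate s τ ⊆ σ
⊆-rotate⇒rotate-⊆ r σ τ⊆ with ⊆-++-comm (take r σ) (drop r σ) τ⊆
... | s , p = s , subst (rotate s _ ⊆_) (take++drop≡id r σ) p

rotate-⊆⇒⊆-rotate : ∀ s τ {σ} → rotate s τ ⊆ σ → ∃ λ r → τ ⊆ rotate r σ
rotate-⊆⇒⊆-rotate s τ ⊆σ with ⊆-++-split (drop s τ) (take s τ) ⊆σ
... | σ₁ , σ₂ , refl , p₁ , p₂ =
  length σ₁ , subst₂ _⊆_ (take++drop≡id s τ) (sym (rotate-++ σ₁ σ₂)) (Sublist.++⁺ p₂ p₁)

map-rotate : ∀ (f : ℕ → ℕ) {σ ρ} → RotEquiv σ ρ → RotEquiv (map f σ) (map f ρ)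
map-rotate f {σ} (r , refl) = r , (begin
  drop r (map f σ) ++ take r (map f σ) ≡⟨ cong₂ _++_ (drop-map r σ) (take-map r σ) ⟩
  map f (drop r σ) ++ map f (take r σ) ≡⟨ map-++ f (drop r σ) (take r σ) ⟨
  map f (drop r σ ++ take r σ)         ∎)

reverse-rotate : ∀ {σ ρ} → RotEquiv σ ρ → RotEquiv (reverse σ) (reverse ρ)
reverse-rotate {σ} (r , refl) = length (reverse back) , (begin
  rotate (length (reverse back)) (reverse σ)
    ≡⟨ cong (λ τ → rotate (length (reverse back)) (reverse τ)) (take++drop≡id r σ) ⟨
  rotate (length (reverse back)) (reverse (front ++ back))
    ≡⟨ cong (rotate (length (reverse back))) (reverse-++ front back) ⟩
  rotate (length (reverse back)) (reverse back ++ reverse front)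
    ≡⟨ rotate-++ (reverse back) (reverse front) ⟩
  reverse front ++ reverse back
    ≡⟨ reverse-++ back front ⟨
  reverse (back ++ front) ∎)
  where
  front = take r σ
  back  = drop r σ

interval : ℕ → ℕ → List ℕ
interval lo zero    = []
interval lo (suc m) = lo ∷ interval (suc lo) m

interval-snoc : ∀ lo m → interval lo (suc m) ≡ interval lo m ++ [ lo + m ]
interval-snoc lo zero    = cong [_] (sym (+-identityʳ lo))
interval-snoc lo (suc m) = cong (lo ∷_) (begin
  interval (suc lo) (suc m)             ≡⟨ interval-snoc (suc lo) m ⟩
  interval (suc lo) m ++ [ suc lo + m ] ≡⟨ cong (λ z → interval (suc lo) m ++ [ z ]) (+-suc lo m) ⟨
  interval (suc lo) m ++ [ lo + suc m ] ∎)

interval-suc : ∀ lo m → interval (suc lo) m ≡ map suc (interval lo m)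
interval-suc lo zero    = refl
interval-suc lo (suc m) = cong (suc lo ∷_) (interval-suc (suc lo) m)

applyUpTo-interval : ∀ (f : ℕ → ℕ) lo m → (∀ i → f i ≡ lo + i) → applyUpTo f m ≡ interval lo m
applyUpTo-interval f lo zero    f≗ = refl
applyUpTo-interval f lo (suc m) f≗ =
  cong₂ _∷_ (trans (f≗ 0) (+-identityʳ lo))
            (applyUpTo-interval (f ∘ suc) (suc lo) m (λ i → trans (f≗ (suc i)) (+-suc lo i)))

applyUpTo-suc≡interval : ∀ n → applyUpTo suc n ≡ interval 1 n
applyUpTo-suc≡interval n = applyUpTo-interval suc 1 n (λ _ → refl)

IsPerm⇒↭interval : ∀ {n σ} → IsPerm n σ → σ ↭ interval 1 n
IsPerm⇒↭interval {n} {σ} = subst (σ ↭_) (applyUpTo-suc≡interval n)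

↭interval⇒IsPerm : ∀ {n σ} → σ ↭ interval 1 n → IsPerm n σ
↭interval⇒IsPerm {n} {σ} = subst (σ ↭_) (sym (applyUpTo-suc≡interval n))

InRange : ℕ → ℕ → ℕ → Set
InRange lo m y = lo ≤ y × y < lo + m

interval-inRange : ∀ lo m → All (InRange lo m) (interval lo m)
interval-inRange lo zero    = []
interval-inRange lo (suc m) = (≤-refl , m<m+n lo z<s) ∷
  All.map (λ {y} (lo<y , y<) → <⇒≤ lo<y , subst (y <_) (sym (+-suc lo m)) y<) (interval-inRange (suc lo) m)

↭-interval⇒inRange : ∀ {lo m τ} → τ ↭ interval lo m → All (InRange lo m) τ
↭-interval⇒inRange τ↭ = All-resp-↭ (↭-sym τ↭) (interval-inRange _ _)

↭-interval⇒lower : ∀ {lo m t} → t ↭ interval (suc lo) m → All (lo <_) t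
↭-interval⇒lower t↭ = All.map proj₁ (↭-interval⇒inRange t↭)

↭-interval⇒upper : ∀ {lo m t} → t ↭ interval lo m → All (_< lo + m) t
↭-interval⇒upper t↭ = All.map proj₂ (↭-interval⇒inRange t↭)

IsPerm⇒≤ : ∀ {n σ} → IsPerm n σ → All (_≤ suc n) σ
IsPerm⇒≤ σ↭ = All.map (λ (_ , x<) → <⇒≤ x<) (↭-interval⇒inRange (IsPerm⇒↭interval σ↭))

interval-max∈ : ∀ lo m → lo + m ∈ interval lo (suc m)
interval-max∈ lo m = subst (lo + m ∈_) (sym (interval-snoc lo m)) (∈-++⁺ʳ (interval lo m) (here refl))

interval-∷-max : ∀ lo m → (lo + m) ∷ interval lo m ↭ interval lo (suc m)
interval-∷-max lo m =
  subst ((lo + m) ∷ interval lo m ↭_) (sym (interval-snoc lo m)) (∷↭∷ʳ (lo + m) (interval lo m))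

↭-interval-∷-max : ∀ {lo m t} → (lo + m) ∷ t ↭ interval lo (suc m) → t ↭ interval lo m
↭-interval-∷-max {lo} {m} t↭ = drop-∷ (↭-trans t↭ (↭-sym (interval-∷-max lo m)))

max-∷-↭-interval : ∀ {lo m t} → t ↭ interval lo m → (lo + m) ∷ t ↭ interval lo (suc m)
max-∷-↭-interval {lo} {m} t↭ = ↭-trans (↭-prep _ t↭) (interval-∷-max lo m)

interval-⊆⇒< : ∀ lo m {b c} → b ∷ c ∷ [] ⊆ interval lo m → b < c
interval-⊆⇒< lo (suc m) (_ ∷ʳ p)    = interval-⊆⇒< (suc lo) m p
interval-⊆⇒< lo (suc m) (refl ∷ p) with Sublist.All-resp-⊆ p (interval-inRange (suc lo) m)
... | (lo<c , _) ∷ [] = lo<c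

Has₂ : (ℕ → ℕ → Set) → List ℕ → Set
Has₂ R τ = ∃₂ λ a b → a ∷ b ∷ [] ⊆ τ × R a b

Has₃ : (ℕ → ℕ → ℕ → Set) → List ℕ → Set
Has₃ R τ = ∃₂ λ a b → ∃ λ c → a ∷ b ∷ c ∷ [] ⊆ τ × R a b c

Has₄ : (ℕ → ℕ → ℕ → ℕ → Set) → List ℕ → Set
Has₄ R τ = ∃₂ λ a b → ∃₂ λ c d → a ∷ b ∷ c ∷ d ∷ [] ⊆ τ × R a b c d

Is21 : ℕ → ℕ → Set
Is21 a b = b < a

Is213 Is231 Is132 : ℕ → ℕ → ℕ → Set
Is213 a b c = b < a × a < c
Is231 a b c = c < a × a < b
Is132 a b c = a < c × c < b

Is4132 : ℕ → ℕ → ℕ → ℕ → Set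
Is4132 a b c d = b < d × d < c × c < a

¬Has₂-tail : ∀ {R x t} → ¬ Has₂ R (x ∷ t) → ¬ Has₂ R t
¬Has₂-tail {x = x} ¬h (a , b , p , r) = ¬h (a , b , x ∷ʳ p , r)

¬Has₃-tail : ∀ {R x t} → ¬ Has₃ R (x ∷ t) → ¬ Has₃ R t
¬Has₃-tail {x = x} ¬h (a , b , c , p , r) = ¬h (a , b , c , x ∷ʳ p , r)

¬Has₄-tail : ∀ {R x t} → ¬ Has₄ R (x ∷ t) → ¬ Has₄ R t
¬Has₄-tail {x = x} ¬h (a , b , c , d , p , r) = ¬h (a , b , c , d , x ∷ʳ p , r)

¬132⇒¬4132 : ∀ {τ} → ¬ Has₃ Is132 τ → ¬ Has₄ Is4132 τ
¬132⇒¬4132 ¬132 (a , b , c , d , p , bd , dc , _) = ¬132 (b , c , d , Sublist.∷ˡ⁻ p , bd , dc)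

interval-avoids₃ : ∀ {R} lo m → (∀ {a b c} → a < b → b < c → ¬ R a b c) → ¬ Has₃ R (interval lo m)
interval-avoids₃ lo m ¬R (a , b , c , p , r) =
  ¬R (interval-⊆⇒< lo m (⊆-trans (refl ∷ refl ∷ c ∷ʳ []) p)) (interval-⊆⇒< lo m (Sublist.∷ˡ⁻ p)) r

bounded-∷-avoids₃ : ∀ {P : ℕ → Set} {R x t} → All P t → (∀ {b c} → P b → P c → ¬ R x b c) →
                    ¬ Has₃ R t → ¬ Has₃ R (x ∷ t)
bounded-∷-avoids₃ _  _  ¬h (a , b , c , _ ∷ʳ p , r) = ¬h (a , b , c , p , r)
bounded-∷-avoids₃ Pt ¬R _  (_ , _ , _ , refl ∷ p , r) with Sublist.All-resp-⊆ p Pt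
... | Pb ∷ Pc ∷ [] = ¬R Pb Pc r

-- Cyclic occurrences of the patterns 1243, 1324, 1423, 1342

data Pat : Set where
  P1243 P1324 P1423 P1342 : Pat

pat : Pat → List ℕ
pat P1243 = p1243
pat P1324 = p1324
pat P1423 = p1423
pat P1342 = p1342

pat-isPerm : ∀ P → IsPerm 4 (pat P)
pat-isPerm P1243 = ↭-prep 1 (↭-prep 2 (↭-swap 4 3 ↭-refl))
pat-isPerm P1324 = ↭-prep 1 (↭-swap 3 2 ↭-refl)
pat-isPerm P1423 = ↭-prep 1 (↭-trans (↭-swap 4 2 ↭-refl) (↭-prep 2 (↭-swap 4 3 ↭-refl)))
pat-isPerm P1342 = ↭-prep 1 (↭-trans (↭-prep 3 (↭-swap 4 2 ↭-refl)) (↭-swap 3 2 ↭-refl))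

length-pat : ∀ P → length (pat P) ≡ 4
length-pat P1243 = refl
length-pat P1324 = refl
length-pat P1423 = refl
length-pat P1342 = refl

Chain : ℕ → ℕ → ℕ → ℕ → Set
Chain x₁ x₂ x₃ x₄ = x₁ < x₂ × x₂ < x₃ × x₃ < x₄

-- The entries of an occurrence of P, read in the order of the values 1,2,3,4 of P, increase.
IsOccurrence : Pat → ℕ → ℕ → ℕ → ℕ → Set
IsOccurrence P1243 a b c d = Chain a b d c
IsOccurrence P1324 a b c d = Chain a c b d
IsOccurrence P1423 a b c d = Chain a c d b
IsOccurrence P1342 a b c d = Chain a d b c

IsCyclicOccurrence : Pat → ℕ → ℕ → ℕ → ℕ → Set
IsCyclicOccurrence P a b c d =
  IsOccurrence P a b c d ⊎ IsOccurrence P b c d a ⊎ IsOccurrence P c d a b ⊎ IsOccurrence P d a b c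

Occurs : Pat → List ℕ → Set
Occurs P = Has₄ (IsCyclicOccurrence P)

-- Outside 1 ≤ k ≤ 4 the value is the junk x₄.
value : ℕ → ℕ → ℕ → ℕ → ℕ → ℕ
value x₁ _  _  _  1 = x₁
value _  x₂ _  _  2 = x₂
value _  _  x₃ _  3 = x₃
value _  _  _  x₄ _ = x₄

value-step : ∀ {x₁ x₂ x₃ x₄} → Chain x₁ x₂ x₃ x₄ →
             ∀ {k} → 1 ≤ k → k < 4 → value x₁ x₂ x₃ x₄ k < value x₁ x₂ x₃ x₄ (suc k)
value-step _           {0} () _
value-step (h , _ , _) {1} _ _ = h
value-step (_ , h , _) {2} _ _ = h
value-step (_ , _ , h) {3} _ _ = h
value-step _ {suc (suc (suc (suc _)))} _ (s≤s (s≤s (s≤s (s≤s ()))))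

strictMono-by-steps : ∀ {f : ℕ → ℕ} {lo hi} → (∀ {k} → lo ≤ k → k < hi → f k < f (suc k)) →
                      ∀ {u v} → lo ≤ u → u < v → v ≤ hi → f u < f v
strictMono-by-steps step {u} {suc v} lo≤u (s≤s u≤v) v<hi with m≤n⇒m<n∨m≡n u≤v
... | inj₁ u<v =
  <-trans (strictMono-by-steps step lo≤u u<v (<⇒≤ v<hi)) (step (≤-trans lo≤u (<⇒≤ u<v)) v<hi)
... | inj₂ refl = step lo≤u v<hi

map-OrdIso : ∀ (f : ℕ → ℕ) π → (∀ {u v} → u ∈ π → v ∈ π → u < v → f u < f v) →
             OrdIso (map f π) π
map-OrdIso f π mono = length-map f π , λ i j →
  subst₂ (λ x y → (x < y) ⇔ (π⟨ i ⟩ < π⟨ j ⟩)) (sym (lookup-map f π i)) (sym (lookup-map f π j))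
         (iso (∈-lookup _) (∈-lookup _))
  where
  π⟨_⟩ : Fin (length (map f π)) → ℕ
  π⟨ i ⟩ = lookup π (cast (length-map f π) i)

  iso : ∀ {u v} → u ∈ π → v ∈ π → (f u < f v) ⇔ (u < v)
  iso {u} {v} u∈ v∈ = mk⇔ reflect (mono u∈ v∈)
    where
    reflect : f u < f v → u < v
    reflect fu<fv with <-cmp u v
    ... | tri< u<v _ _ = u<v
    ... | tri≈ _ refl _ = ⊥-elim (<-irrefl refl fu<fv)
    ... | tri> _ _ v<u = ⊥-elim (<-asym fu<fv (mono v∈ u∈ v<u))

chain⇒OrdIso : ∀ {x₁ x₂ x₃ x₄} π → IsPerm 4 π → Chain x₁ x₂ x₃ x₄ →
               OrdIso (map (value x₁ x₂ x₃ x₄) π) π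
chain⇒OrdIso π π↭ h = map-OrdIso _ π λ u∈ v∈ u<v →
  strictMono-by-steps (value-step h) (proj₁ (range u∈)) u<v (≤-pred (proj₂ (range v∈)))
  where
  range : ∀ {u} → u ∈ π → InRange 1 4 u
  range u∈ = All.lookup (↭-interval⇒inRange π↭) u∈

-- For the x's of the chain IsOccurrence P a b c d, map (value x₁ x₂ x₃ x₄) (pat P) computes to
-- a ∷ b ∷ c ∷ d ∷ [].
occurrence⇒OrdIso : ∀ P {a b c d} → IsOccurrence P a b c d → OrdIso (a ∷ b ∷ c ∷ d ∷ []) (pat P)
occurrence⇒OrdIso P1243 = chain⇒OrdIso (pat P1243) (pat-isPerm P1243)
occurrence⇒OrdIso P1324 = chain⇒OrdIso (pat P1324) (pat-isPerm P1324)
occurrence⇒OrdIso P1423 = chain⇒OrdIso (pat P1423) (pat-isPerm P1423)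
occurrence⇒OrdIso P1342 = chain⇒OrdIso (pat P1342) (pat-isPerm P1342)

-- The implicit argument is discharged by computation when π, i and j are literals.
ordered : ∀ {τ π} (iso : OrdIso τ π) i j →
          {T (lookup π (cast (proj₁ iso) i) <ᵇ lookup π (cast (proj₁ iso) j))} → lookup τ i < lookup τ j
ordered (_ , iso) i j {π<ᵇ} = Equivalence.from (iso i j) (<ᵇ⇒< _ _ π<ᵇ)

OrdIso⇒occurrence : ∀ P {a b c d} → OrdIso (a ∷ b ∷ c ∷ d ∷ []) (pat P) → IsOccurrence P a b c d
OrdIso⇒occurrence P1243 iso = ordered iso (# 0) (# 1) , ordered iso (# 1) (# 3) , ordered iso (# 3) (# 2)
OrdIso⇒occurrence P1324 iso = ordered iso (# 0) (# 2) , ordered iso (# 2) (# 1) , ordered iso (# 1) (# 3)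
OrdIso⇒occurrence P1423 iso = ordered iso (# 0) (# 2) , ordered iso (# 2) (# 3) , ordered iso (# 3) (# 1)
OrdIso⇒occurrence P1342 iso = ordered iso (# 0) (# 3) , ordered iso (# 3) (# 1) , ordered iso (# 1) (# 2)

IsCyclicOccurrence-rotate : ∀ {P a b c d} → IsCyclicOccurrence P a b c d → IsCyclicOccurrence P b c d a
IsCyclicOccurrence-rotate (inj₁ h)                 = inj₂ (inj₂ (inj₂ h))
IsCyclicOccurrence-rotate (inj₂ (inj₁ h))          = inj₁ h
IsCyclicOccurrence-rotate (inj₂ (inj₂ (inj₁ h)))   = inj₂ (inj₁ h)
IsCyclicOccurrence-rotate (inj₂ (inj₂ (inj₂ h)))   = inj₂ (inj₂ (inj₁ h))

rotate-⊆⇒Occurs : ∀ {P} s {a b c d σ} → rotate s (a ∷ b ∷ c ∷ d ∷ []) ⊆ σ →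
                  IsCyclicOccurrence P a b c d → Occurs P σ
rotate-⊆⇒Occurs 0 p h = _ , _ , _ , _ , p , h
rotate-⊆⇒Occurs 1 p h = _ , _ , _ , _ , p , rot h
  where rot = IsCyclicOccurrence-rotate
rotate-⊆⇒Occurs 2 p h = _ , _ , _ , _ , p , rot (rot h)
  where rot = IsCyclicOccurrence-rotate
rotate-⊆⇒Occurs 3 p h = _ , _ , _ , _ , p , rot (rot (rot h))
  where rot = IsCyclicOccurrence-rotate
rotate-⊆⇒Occurs (suc (suc (suc (suc s)))) {σ = σ} p h =
  rotate-⊆⇒Occurs 0 (subst (_⊆ σ) (cong₂ (λ xs ys → xs ++ _ ∷ _ ∷ _ ∷ _ ∷ ys) (drop-[] s) (take-[] s)) p)
                    h

Occurs-++-comm : ∀ {P} xs ys → Occurs P (ys ++ xs) → Occurs P (xs ++ ys)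
Occurs-++-comm xs ys (_ , _ , _ , _ , p , h) with ⊆-++-comm xs ys p
... | s , p′ = rotate-⊆⇒Occurs s p′ h

CycContains⇒Occurs : ∀ P σ → CycContains σ (pat P) → Occurs P σ
CycContains⇒Occurs P σ (r , τ , τ⊆ , iso) = occurs τ (trans (proj₁ iso) (length-pat P)) τ⊆ iso
  where
  occurs : ∀ τ → length τ ≡ 4 → τ ⊆ rotate r σ → OrdIso τ (pat P) → Occurs P σ
  occurs (_ ∷ _ ∷ _ ∷ _ ∷ []) _ τ⊆ iso with ⊆-rotate⇒rotate-⊆ r σ τ⊆
  ... | s , p = rotate-⊆⇒Occurs s p (inj₁ (OrdIso⇒occurrence P iso))

rotate-⊆⇒CycContains : ∀ s τ {σ π} → rotate s τ ⊆ σ → OrdIso τ π → CycContains σ π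
rotate-⊆⇒CycContains s τ p iso with rotate-⊆⇒⊆-rotate s τ p
... | r , τ⊆ = r , τ , τ⊆ , iso

Occurs⇒CycContains : ∀ P σ → Occurs P σ → CycContains σ (pat P)
Occurs⇒CycContains P σ (a , b , c , d , p , inj₁ h) =
  rotate-⊆⇒CycContains 0 (a ∷ b ∷ c ∷ d ∷ []) {π = pat P} p (occurrence⇒OrdIso P h)
Occurs⇒CycContains P σ (a , b , c , d , p , inj₂ (inj₁ h)) =
  rotate-⊆⇒CycContains 3 (b ∷ c ∷ d ∷ a ∷ []) {π = pat P} p (occurrence⇒OrdIso P h)
Occurs⇒CycContains P σ (a , b , c , d , p , inj₂ (inj₂ (inj₁ h))) =
  rotate-⊆⇒CycContains 2 (c ∷ d ∷ a ∷ b ∷ []) {π = pat P} p (occurrence⇒OrdIso P h)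
Occurs⇒CycContains P σ (a , b , c , d , p , inj₂ (inj₂ (inj₂ h))) =
  rotate-⊆⇒CycContains 1 (d ∷ a ∷ b ∷ c ∷ []) {π = pat P} p (occurrence⇒OrdIso P h)

-- Permutations avoiding 213, 231 and 132 or 4132

between-head-has-213-or-231 : ∀ {lo hi x t} → lo ∈ t → hi ∈ t → lo < x → x < hi →
                              Has₃ Is213 (x ∷ t) ⊎ Has₃ Is231 (x ∷ t)
between-head-has-213-or-231 {lo} {hi} {x} lo∈ hi∈ lo<x x<hi
  with ∈-pair⇒⊆ lo∈ hi∈ (<⇒≢ (<-trans lo<x x<hi))
... | inj₁ p = inj₁ (x , lo , hi , refl ∷ p , lo<x , x<hi)
... | inj₂ p = inj₂ (x , hi , lo , refl ∷ p , lo<x , x<hi)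

head-min-or-max : ∀ {lo k x t} → x ∷ t ↭ interval lo (suc (suc k)) →
                  ¬ Has₃ Is213 (x ∷ t) → ¬ Has₃ Is231 (x ∷ t) → x ≡ lo ⊎ x ≡ lo + suc k
head-min-or-max {lo} {k} {x} {t} x∷t↭ ¬213 ¬231 with x ≟ lo | x ≟ lo + suc k | ↭-interval⇒inRange x∷t↭
... | yes x≡lo | _        | _ = inj₁ x≡lo
... | no _     | yes x≡hi | _ = inj₂ x≡hi
... | no x≢lo  | no x≢hi  | (lo≤x , x<) ∷ _
  with between-head-has-213-or-231 (↭-∈-tail x∷t↭ (here refl) x≢lo)
                                    (↭-∈-tail x∷t↭ (interval-max∈ lo (suc k)) x≢hi)
                                    (≤∧≢⇒< lo≤x (λ lo≡x → x≢lo (sym lo≡x)))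
                                    (≤∧≢⇒< (≤-pred (subst (x <_) (+-suc lo (suc k)) x<)) x≢hi)
... | inj₁ has213 = ⊥-elim (¬213 has213)
... | inj₂ has231 = ⊥-elim (¬231 has231)

↭-interval-no21⇒≡ : ∀ {lo} m τ → τ ↭ interval lo m → ¬ Has₂ Is21 τ → τ ≡ interval lo m
↭-interval-no21⇒≡ zero    τ       τ↭ _   = ↭-empty-inv τ↭
↭-interval-no21⇒≡ (suc m) []      τ↭ _   = ⊥-elim (¬[]↭∷ τ↭)
↭-interval-no21⇒≡ {lo} (suc m) (x ∷ t) τ↭ ¬21 with x ≟ lo | ↭-interval⇒inRange τ↭
... | yes refl | _ = cong (lo ∷_) (↭-interval-no21⇒≡ m t (drop-∷ τ↭) (¬Has₂-tail ¬21))
... | no x≢lo  | (lo≤x , _) ∷ _ =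
  ⊥-elim (¬21 (x , lo , refl ∷ from∈ (↭-∈-tail τ↭ (here refl) x≢lo) ,
               ≤∧≢⇒< lo≤x (λ lo≡x → x≢lo (sym lo≡x))))

Av[213,231,132] : ℕ → ℕ → List ℕ → Set
Av[213,231,132] lo m τ = τ ↭ interval lo m × ¬ Has₃ Is213 τ × ¬ Has₃ Is231 τ × ¬ Has₃ Is132 τ

Av[213,231,4132] : ℕ → ℕ → List ℕ → Set
Av[213,231,4132] lo m τ = τ ↭ interval lo m × ¬ Has₃ Is213 τ × ¬ Has₃ Is231 τ × ¬ Has₄ Is4132 τ

Av[213,231,132]⇒Av[213,231,4132] : ∀ {lo m τ} → Av[213,231,132] lo m τ → Av[213,231,4132] lo m τ
Av[213,231,132]⇒Av[213,231,4132] (τ↭ , ¬213 , ¬231 , ¬132) = τ↭ , ¬213 , ¬231 , ¬132⇒¬4132 ¬132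

interval-Av[213,231,132] : ∀ lo m → Av[213,231,132] lo m (interval lo m)
interval-Av[213,231,132] lo m =
  ↭-refl ,
  interval-avoids₃ lo m (λ a<b _ (b<a , _) → <-asym a<b b<a) ,
  interval-avoids₃ lo m (λ a<b b<c (c<a , _) → <-asym (<-trans a<b b<c) c<a) ,
  interval-avoids₃ lo m (λ _ b<c (_ , c<b) → <-asym b<c c<b)

max-∷-Av[213,231,132] : ∀ {lo m t} → Av[213,231,132] lo m t → Av[213,231,132] lo (suc m) (lo + m ∷ t)
max-∷-Av[213,231,132] (t↭ , ¬213 , ¬231 , ¬132) =
  max-∷-↭-interval t↭ ,
  bounded-∷-avoids₃ below (λ _ c<x (_ , x<c) → <-asym x<c c<x) ¬213 ,
  bounded-∷-avoids₃ below (λ b<x _ (_ , x<b) → <-asym x<b b<x) ¬231 ,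
  bounded-∷-avoids₃ below (λ b<x _ (x<c , c<b) → <-asym (<-trans x<c c<b) b<x) ¬132
  where below = ↭-interval⇒upper t↭

max-∷-Av[213,231,132]⁻ : ∀ {lo m t} → Av[213,231,132] lo (suc m) (lo + m ∷ t) → Av[213,231,132] lo m t
max-∷-Av[213,231,132]⁻ (τ↭ , ¬213 , ¬231 , ¬132) =
  ↭-interval-∷-max τ↭ , ¬Has₃-tail ¬213 , ¬Has₃-tail ¬231 , ¬Has₃-tail ¬132

min-∷-Av[213,231,4132] : ∀ {lo m t} → Av[213,231,4132] (suc lo) m t → Av[213,231,4132] lo (suc m) (lo ∷ t)
min-∷-Av[213,231,4132] {lo} {t = t} (t↭ , ¬213 , ¬231 , ¬4132) =
  ↭-prep lo t↭ ,
  bounded-∷-avoids₃ above (λ lo<b _ (b<lo , _) → <-asym lo<b b<lo) ¬213 ,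
  bounded-∷-avoids₃ above (λ _ lo<c (c<lo , _) → <-asym lo<c c<lo) ¬231 ,
  ¬4132-lo
  where
  above = ↭-interval⇒lower t↭
  ¬4132-lo : ¬ Has₄ Is4132 (lo ∷ t)
  ¬4132-lo (_ , _ , _ , _ , _ ∷ʳ p , r) = ¬4132 (_ , _ , _ , _ , p , r)
  ¬4132-lo (_ , _ , _ , _ , refl ∷ p , _ , _ , c<lo) with Sublist.All-resp-⊆ p above
  ... | _ ∷ lo<c ∷ _ ∷ [] = <-asym lo<c c<lo

enum[213,231,132] : ℕ → ℕ → List (List ℕ)
enum[213,231,132] lo 0             = [ interval lo 0 ]
enum[213,231,132] lo 1             = [ interval lo 1 ]
enum[213,231,132] lo (suc (suc k)) =
  interval lo (suc (suc k)) ∷ map ((lo + suc k) ∷_) (enum[213,231,132] lo (suc k))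

enum[213,231,4132] : ℕ → ℕ → List (List ℕ)
enum[213,231,4132] lo 0             = [ interval lo 0 ]
enum[213,231,4132] lo 1             = [ interval lo 1 ]
enum[213,231,4132] lo (suc (suc k)) =
  map (lo ∷_) (enum[213,231,4132] (suc lo) (suc k)) ++ map ((lo + suc k) ∷_) (enum[213,231,132] lo (suc k))

enum[213,231,132]-sound : ∀ lo m → All (Av[213,231,132] lo m) (enum[213,231,132] lo m)
enum[213,231,132]-sound lo 0             = interval-Av[213,231,132] lo 0 ∷ []
enum[213,231,132]-sound lo 1             = interval-Av[213,231,132] lo 1 ∷ []
enum[213,231,132]-sound lo (suc (suc k)) =
  interval-Av[213,231,132] lo (suc (suc k)) ∷
  Allₚ.map⁺ (All.map max-∷-Av[213,231,132] (enum[213,231,132]-sound lo (suc k)))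

enum[213,231,4132]-sound : ∀ lo m → All (Av[213,231,4132] lo m) (enum[213,231,4132] lo m)
enum[213,231,4132]-sound lo 0 = Av[213,231,132]⇒Av[213,231,4132] {lo} {0} (interval-Av[213,231,132] lo 0) ∷ []
enum[213,231,4132]-sound lo 1 = Av[213,231,132]⇒Av[213,231,4132] {lo} {1} (interval-Av[213,231,132] lo 1) ∷ []
enum[213,231,4132]-sound lo (suc (suc k)) = Allₚ.++⁺
  (Allₚ.map⁺ (All.map min-∷-Av[213,231,4132] (enum[213,231,4132]-sound (suc lo) (suc k))))
  (Allₚ.map⁺ (All.map (Av[213,231,132]⇒Av[213,231,4132] ∘ max-∷-Av[213,231,132])
                      (enum[213,231,132]-sound lo (suc k))))

enum[213,231,132]-complete : ∀ lo m {τ} → Av[213,231,132] lo m τ → τ ∈ enum[213,231,132] lo m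
enum[213,231,132]-complete lo 0 (τ↭ , _) = here (↭-empty-inv τ↭)
enum[213,231,132]-complete lo 1 (τ↭ , _) = here (↭-singleton-inv τ↭)
enum[213,231,132]-complete lo (suc (suc k)) {[]} (τ↭ , _) = ⊥-elim (¬[]↭∷ τ↭)
enum[213,231,132]-complete lo (suc (suc k)) {x ∷ t} av@(τ↭ , ¬213 , ¬231 , ¬132)
  with head-min-or-max τ↭ ¬213 ¬231
... | inj₁ refl = here (cong (lo ∷_) (↭-interval-no21⇒≡ (suc k) t (drop-∷ τ↭) ¬21))
  where
  ¬21 : ¬ Has₂ Is21 t
  ¬21 (b , c , p , c<b) with Sublist.All-resp-⊆ p (↭-interval⇒lower (drop-∷ τ↭))
  ... | _ ∷ lo<c ∷ [] = ¬132 (lo , b , c , refl ∷ p , lo<c , c<b)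
... | inj₂ refl = there (∈-map⁺ ((lo + suc k) ∷_)
                    (enum[213,231,132]-complete lo (suc k) (max-∷-Av[213,231,132]⁻ av)))

enum[213,231,4132]-complete : ∀ lo m {τ} → Av[213,231,4132] lo m τ → τ ∈ enum[213,231,4132] lo m
enum[213,231,4132]-complete lo 0 (τ↭ , _) = here (↭-empty-inv τ↭)
enum[213,231,4132]-complete lo 1 (τ↭ , _) = here (↭-singleton-inv τ↭)
enum[213,231,4132]-complete lo (suc (suc k)) {[]} (τ↭ , _) = ⊥-elim (¬[]↭∷ τ↭)
enum[213,231,4132]-complete lo (suc (suc k)) {x ∷ t} (τ↭ , ¬213 , ¬231 , ¬4132)
  with head-min-or-max τ↭ ¬213 ¬231
... | inj₁ refl = ∈-++⁺ˡ (∈-map⁺ (lo ∷_) (enum[213,231,4132]-complete (suc lo) (suc k)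
                    (drop-∷ τ↭ , ¬Has₃-tail ¬213 , ¬Has₃-tail ¬231 , ¬Has₄-tail ¬4132)))
... | inj₂ refl = ∈-++⁺ʳ _ (∈-map⁺ ((lo + suc k) ∷_) (enum[213,231,132]-complete lo (suc k)
                    (t↭ , ¬Has₃-tail ¬213 , ¬Has₃-tail ¬231 , ¬132)))
  where
  t↭ = ↭-interval-∷-max τ↭
  ¬132 : ¬ Has₃ Is132 t
  ¬132 (b , c , d , p , bd , dc) with Sublist.All-resp-⊆ p (↭-interval⇒upper t↭)
  ... | _ ∷ c<hi ∷ _ ∷ [] = ¬4132 (lo + suc k , b , c , d , refl ∷ p , bd , dc , c<hi)

length-enum[213,231,132] : ∀ lo k → length (enum[213,231,132] lo (suc k)) ≡ suc k
length-enum[213,231,132] lo zero    = refl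
length-enum[213,231,132] lo (suc k) =
  cong suc (trans (length-map _ (enum[213,231,132] lo (suc k))) (length-enum[213,231,132] lo k))

length-enum[213,231,4132] : ∀ lo m → length (enum[213,231,4132] lo m) ≡ 1 + m C 2
length-enum[213,231,4132] lo 0             = refl
length-enum[213,231,4132] lo 1             = refl
length-enum[213,231,4132] lo (suc (suc k)) = begin
  length (map (lo ∷_) mins ++ map ((lo + suc k) ∷_) maxs)  ≡⟨ length-++ (map (lo ∷_) mins) ⟩
  length (map (lo ∷_) mins) + length (map _ maxs)         ≡⟨ cong₂ _+_ (length-map _ mins) (length-map _ maxs) ⟩
  length mins + length maxs                               ≡⟨ cong₂ _+_ (length-enum[213,231,4132] (suc lo) (suc k))
                                                                        (length-enum[213,231,132] lo k) ⟩
  suc (suc k C 2 + suc k)                                 ≡⟨ cong suc (+-comm (suc k C 2) (suc k)) ⟩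
  suc (suc k + suc k C 2)                                 ≡⟨ cong (λ n → suc (n + suc k C 2)) (nC1≡n (suc k)) ⟨
  suc (suc k C 1 + suc k C 2)                             ≡⟨ cong suc (nCk+nC[k+1]≡[n+1]C[k+1] (suc k) 1) ⟩
  1 + suc (suc k) C 2                                     ∎
  where
  mins = enum[213,231,4132] (suc lo) (suc k)
  maxs = enum[213,231,132] lo (suc k)

min≢max : ∀ lo k → lo ≢ lo + suc k
min≢max lo k = <⇒≢ (m<m+n lo z<s)

enum[213,231,132]-unique : ∀ lo m → Unique (enum[213,231,132] lo m)
enum[213,231,132]-unique lo 0             = [] ∷ []
enum[213,231,132]-unique lo 1             = [] ∷ []
enum[213,231,132]-unique lo (suc (suc k)) =
  Allₚ.map⁺ (All.universal (λ _ eq → min≢max lo k (∷-injectiveˡ eq)) _) ∷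
  Unique.map⁺ ∷-injectiveʳ (enum[213,231,132]-unique lo (suc k))

enum[213,231,4132]-unique : ∀ lo m → Unique (enum[213,231,4132] lo m)
enum[213,231,4132]-unique lo 0             = [] ∷ []
enum[213,231,4132]-unique lo 1             = [] ∷ []
enum[213,231,4132]-unique lo (suc (suc k)) = Unique.++⁺
  (Unique.map⁺ ∷-injectiveʳ (enum[213,231,4132]-unique (suc lo) (suc k)))
  (Unique.map⁺ ∷-injectiveʳ (enum[213,231,132]-unique lo (suc k)))
  disjoint
  where
  disjoint : ∀ {τ} → ¬ (τ ∈ map (lo ∷_) (enum[213,231,4132] (suc lo) (suc k))
                      × τ ∈ map ((lo + suc k) ∷_) (enum[213,231,132] lo (suc k)))
  disjoint (∈mins , ∈maxs) with ∈-map⁻ (lo ∷_) ∈mins | ∈-map⁻ ((lo + suc k) ∷_) ∈maxs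
  ... | _ , _ , refl | _ , _ , eq = min≢max lo k (∷-injectiveˡ eq)

-- Cyclic permutations avoiding [1324] and [1342]

-- Each rotation of 1324 contains a 213 or a 231, or is itself a 4132.
¬Occurs1324 : ∀ {τ} → ¬ Has₃ Is213 τ → ¬ Has₃ Is231 τ → ¬ Has₄ Is4132 τ → ¬ Occurs P1324 τ
¬Occurs1324 ¬213 _ _ (a , b , c , d , p , inj₁ (_ , cb , bd)) =
  ¬213 (b , c , d , Sublist.∷ˡ⁻ p , cb , bd)
¬Occurs1324 _ _ ¬4132 (a , b , c , d , p , inj₂ (inj₁ h)) =
  ¬4132 (a , b , c , d , p , h)
¬Occurs1324 _ ¬231 _ (a , b , c , d , p , inj₂ (inj₂ (inj₁ (ca , ad , db)))) =
  ¬231 (a , b , c , ⊆-init p , ca , <-trans ad db)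
¬Occurs1324 ¬213 _ _ (a , b , c , d , p , inj₂ (inj₂ (inj₂ (_ , ba , ac)))) =
  ¬213 (a , b , c , ⊆-init p , ba , ac)

-- Each rotation of 1342 contains a 213 or a 231.
¬Occurs1342 : ∀ {τ} → ¬ Has₃ Is213 τ → ¬ Has₃ Is231 τ → ¬ Occurs P1342 τ
¬Occurs1342 _ ¬231 (a , b , c , d , p , inj₁ (_ , db , bc)) =
  ¬231 (b , c , d , Sublist.∷ˡ⁻ p , db , bc)
¬Occurs1342 ¬213 _ (a , b , c , d , p , inj₂ (inj₁ (ba , ac , _))) =
  ¬213 (a , b , c , ⊆-init p , ba , ac)
¬Occurs1342 ¬213 _ (a , b , c , d , p , inj₂ (inj₂ (inj₁ (cb , bd , _)))) =
  ¬213 (b , c , d , Sublist.∷ˡ⁻ p , cb , bd)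
¬Occurs1342 _ ¬231 (a , b , c , d , p , inj₂ (inj₂ (inj₂ (_ , ca , ab)))) =
  ¬231 (a , b , c , ⊆-init p , ca , ab)

-- An occurrence through the leading 1 must use it as the 1 of the pattern.
1∷-¬Occurs1324 : ∀ {m τ} → Av[213,231,4132] 2 m τ → ¬ Occurs P1324 (1 ∷ τ)
1∷-¬Occurs1324 (_ , ¬213 , ¬231 , ¬4132) (a , b , c , d , _ ∷ʳ p , h) =
  ¬Occurs1324 ¬213 ¬231 ¬4132 (a , b , c , d , p , h)
1∷-¬Occurs1324 (τ↭ , ¬213 , _ , _) (_ , b , c , d , refl ∷ p , h)
  with Sublist.All-resp-⊆ p (↭-interval⇒lower τ↭) | h
... | _                | inj₁ (_ , cb , bd)               = ¬213 (b , c , d , p , cb , bd)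
... | _ ∷ 1<c ∷ _ ∷ [] | inj₂ (inj₁ (_ , _ , c<1))        = <-asym 1<c c<1
... | _ ∷ 1<c ∷ _ ∷ [] | inj₂ (inj₂ (inj₁ (c<1 , _)))     = <-asym 1<c c<1
... | 1<b ∷ _ ∷ _ ∷ [] | inj₂ (inj₂ (inj₂ (_ , b<1 , _))) = <-asym 1<b b<1

1∷-¬Occurs1342 : ∀ {m τ} → Av[213,231,4132] 2 m τ → ¬ Occurs P1342 (1 ∷ τ)
1∷-¬Occurs1342 (_ , ¬213 , ¬231 , _) (a , b , c , d , _ ∷ʳ p , h) =
  ¬Occurs1342 ¬213 ¬231 (a , b , c , d , p , h)
1∷-¬Occurs1342 (τ↭ , _ , ¬231 , _) (_ , b , c , d , refl ∷ p , h)
  with Sublist.All-resp-⊆ p (↭-interval⇒lower τ↭) | h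
... | _                | inj₁ (_ , db , bc)                = ¬231 (b , c , d , p , db , bc)
... | 1<b ∷ _ ∷ _ ∷ [] | inj₂ (inj₁ (b<1 , _))             = <-asym 1<b b<1
... | _ ∷ _ ∷ 1<d ∷ [] | inj₂ (inj₂ (inj₁ (_ , _ , d<1)))  = <-asym 1<d d<1
... | _ ∷ 1<c ∷ _ ∷ [] | inj₂ (inj₂ (inj₂ (_ , c<1 , _)))  = <-asym 1<c c<1

normal-form-avoids : ∀ {m τ} → Av[213,231,4132] 2 m τ → Avoids (p1324 ∷ p1342 ∷ []) (1 ∷ τ)
normal-form-avoids av =
  (λ c → 1∷-¬Occurs1324 av (CycContains⇒Occurs P1324 _ c)) ∷
  (λ c → 1∷-¬Occurs1342 av (CycContains⇒Occurs P1342 _ c)) ∷ []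

avoider-normal-form : ∀ {m σ} → IsPerm (suc m) σ → Avoids (p1324 ∷ p1342 ∷ []) σ →
                      ∃ λ τ → Av[213,231,4132] 2 m τ × RotEquiv σ (1 ∷ τ)
avoider-normal-form {m} {σ} σ↭ (¬1324 ∷ ¬1342 ∷ [])
  with ∈-∃++ (∈-resp-↭ (↭-sym (IsPerm⇒↭interval σ↭)) (here refl))
... | A , B , refl = B ++ A , (τ↭ , ¬213 , ¬231 , ¬4132) , length A , rotate-++ A (1 ∷ B)
  where
  τ↭ : B ++ A ↭ interval 2 m
  τ↭ = ↭-trans (++-comm B A) (drop-mid A [] (IsPerm⇒↭interval σ↭))
  1<τ : All (1 <_) (B ++ A)
  1<τ = ↭-interval⇒lower τ↭
  ¬Occurs : ∀ P → ¬ CycContains (A ++ 1 ∷ B) (pat P) → ¬ Occurs P (1 ∷ B ++ A)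
  ¬Occurs P ¬c o = ¬c (Occurs⇒CycContains P _ (Occurs-++-comm A (1 ∷ B) o))
  ¬213 : ¬ Has₃ Is213 (B ++ A)
  ¬213 (a , b , c , p , ba , ac) with Sublist.All-resp-⊆ p 1<τ
  ... | _ ∷ 1<b ∷ _ ∷ [] = ¬Occurs P1324 ¬1324 (1 , a , b , c , refl ∷ p , inj₁ (1<b , ba , ac))
  ¬231 : ¬ Has₃ Is231 (B ++ A)
  ¬231 (a , b , c , p , ca , ab) with Sublist.All-resp-⊆ p 1<τ
  ... | _ ∷ _ ∷ 1<c ∷ [] = ¬Occurs P1342 ¬1342 (1 , a , b , c , refl ∷ p , inj₁ (1<c , ca , ab))
  ¬4132 : ¬ Has₄ Is4132 (B ++ A)
  ¬4132 (a , b , c , d , p , h) = ¬Occurs P1324 ¬1324 (a , b , c , d , 1 ∷ʳ p , inj₂ (inj₁ h))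

rotate-1∷-injective : ∀ r {t t′} → All (1 <_) t → rotate r (1 ∷ t) ≡ 1 ∷ t′ → t ≡ t′
rotate-1∷-injective zero    {t} _ eq = trans (sym (++-identityʳ t)) (∷-injectiveʳ eq)
rotate-1∷-injective (suc r) {t} {t′} 1<t eq with drop r t in drop≡ | Allₚ.drop⁺ r 1<t
... | y ∷ _ | 1<y ∷ _ = ⊥-elim (<-irrefl (sym (∷-injectiveˡ eq)) 1<y)
... | []    | _       = begin
  t                    ≡⟨ take++drop≡id r t ⟨
  take r t ++ drop r t ≡⟨ cong (take r t ++_) drop≡ ⟩
  take r t ++ []       ≡⟨ ++-identityʳ (take r t) ⟩
  take r t             ≡⟨ ∷-injectiveʳ eq ⟩
  t′                   ∎

normal-forms-distinct : ∀ {m t t′} → Av[213,231,4132] 2 m t → t ≢ t′ → ¬ RotEquiv (1 ∷ t) (1 ∷ t′)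
normal-forms-distinct (t↭ , _) t≢t′ (r , eq) = t≢t′ (rotate-1∷-injective r (↭-interval⇒lower t↭) eq)

AvCount-1324-1342 : ∀ n → AvCount (p1324 ∷ p1342 ∷ []) n (1 + (n ∸ 1) C 2)
AvCount-1324-1342 zero = [ [] ] , refl , (↭-refl , ¬[] {P1324} ∷ ¬[] {P1342} ∷ []) ∷ [] , [] ∷ [] , only-[]
  where
  ¬[] : ∀ {P} → ¬ CycContains [] (pat P)
  ¬[] {P} c with CycContains⇒Occurs P [] c
  ... | _ , _ , _ , _ , () , _
  only-[] : ∀ σ → IsPerm 0 σ → Avoids (p1324 ∷ p1342 ∷ []) σ → Any (RotEquiv σ) [ [] ]
  only-[] σ σ↭ _ with ↭-empty-inv σ↭
  ... | refl = here (0 , refl)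
AvCount-1324-1342 (suc m) =
  map (1 ∷_) forms ,
  trans (length-map (1 ∷_) forms) (length-enum[213,231,4132] 2 m) ,
  Allₚ.map⁺ (All.map (λ av → ↭interval⇒IsPerm (↭-prep 1 (proj₁ av)) , normal-form-avoids av) sound) ,
  AllPairsₚ.map⁺ (AllPairs-mapᵖ (λ av _ → normal-forms-distinct av) sound (enum[213,231,4132]-unique 2 m)) ,
  complete
  where
  forms = enum[213,231,4132] 2 m
  sound = enum[213,231,4132]-sound 2 m
  complete : ∀ σ → IsPerm (suc m) σ → Avoids (p1324 ∷ p1342 ∷ []) σ →
             Any (RotEquiv σ) (map (1 ∷_) forms)
  complete σ σ↭ avoids with avoider-normal-form σ↭ avoids
  ... | τ , av , σ~1∷τ =
    Any.map (λ { refl → σ~1∷τ }) (∈-map⁺ (1 ∷_) (enum[213,231,4132]-complete 2 m av))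

-- Reversal and complementation

record CyclicSymmetry (n : ℕ) : Set where
  field
    act         : List ℕ → List ℕ
    act-pat     : Pat → Pat
    act-perm    : ∀ {σ} → IsPerm n σ → IsPerm n (act σ)
    act-invol   : ∀ {σ} → IsPerm n σ → act (act σ) ≡ σ
    act-rotate  : ∀ {σ ρ} → RotEquiv σ ρ → RotEquiv (act σ) (act ρ)
    act-occurs  : ∀ P {σ} → IsPerm n σ → Occurs P (act σ) → Occurs (act-pat P) σ

module _ {n} (S : CyclicSymmetry n) where
  open CyclicSymmetry S

  act-avoids : ∀ {ps qs σ} → All (λ P → act-pat P ∈ ps) qs → IsPerm n σ →
               Avoids (map pat ps) σ → Avoids (map pat qs) (act σ)
  act-avoids qs→ps σ↭ avoids = Allₚ.map⁺ (All.map (λ {P} actP∈ c →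
    All.lookup (Allₚ.map⁻ avoids) actP∈
      (Occurs⇒CycContains (act-pat P) _ (act-occurs P σ↭ (CycContains⇒Occurs P _ c)))) qs→ps)

  AvCount-transport : ∀ {ps qs k} → All (λ P → act-pat P ∈ ps) qs → All (λ P → act-pat P ∈ qs) ps →
                      AvCount (map pat ps) n k → AvCount (map pat qs) n k
  AvCount-transport {ps} qs→ps ps→qs (L , length≡ , valid , distinct , complete) =
    map act L ,
    trans (length-map act L) length≡ ,
    Allₚ.map⁺ (All.map (λ (σ↭ , avoids) → act-perm σ↭ , act-avoids qs→ps σ↭ avoids) valid) ,
    AllPairsₚ.map⁺ (AllPairs-mapᵖ separated valid distinct) ,
    λ σ σ↭ avoids →
      Anyₚ.map⁺ (Any.map (λ {ρ} σ~ρ → subst (λ τ → RotEquiv τ (act ρ)) (act-invol σ↭) (act-rotate σ~ρ))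
                         (complete (act σ) (act-perm σ↭) (act-avoids ps→qs σ↭ avoids)))
    where
    separated : ∀ {σ ρ} → IsPerm n σ × Avoids (map pat ps) σ → IsPerm n ρ × Avoids (map pat ps) ρ →
                ¬ RotEquiv σ ρ → ¬ RotEquiv (act σ) (act ρ)
    separated (σ↭ , _) (ρ↭ , _) σ≁ρ act-σ~ρ =
      σ≁ρ (subst₂ RotEquiv (act-invol σ↭) (act-invol ρ↭) (act-rotate act-σ~ρ))

reversePat : Pat → Pat
reversePat P1243 = P1342
reversePat P1324 = P1423
reversePat P1423 = P1324
reversePat P1342 = P1243

-- reverse (a b c d) is d c b a, whose rotation a d c b keeps a in front.
reverse-occurrence : ∀ P {a b c d} → IsOccurrence P a b c d → IsOccurrence (reversePat P) a d c b
reverse-occurrence P1243 h = h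
reverse-occurrence P1324 h = h
reverse-occurrence P1423 h = h
reverse-occurrence P1342 h = h

reverse-cyclicOccurrence : ∀ P {a b c d} → IsCyclicOccurrence P a b c d → IsCyclicOccurrence (reversePat P) d c b a
reverse-cyclicOccurrence P (inj₁ h)               = inj₂ (inj₂ (inj₂ (reverse-occurrence P h)))
reverse-cyclicOccurrence P (inj₂ (inj₁ h))        = inj₂ (inj₂ (inj₁ (reverse-occurrence P h)))
reverse-cyclicOccurrence P (inj₂ (inj₂ (inj₁ h))) = inj₂ (inj₁ (reverse-occurrence P h))
reverse-cyclicOccurrence P (inj₂ (inj₂ (inj₂ h))) = inj₁ (reverse-occurrence P h)

reversal : ∀ n → CyclicSymmetry n
reversal n = record
  { act        = reverse
  ; act-pat    = reversePat
  ; act-perm   = λ {σ} σ↭ → ↭-trans (Permutation.↭-reverse σ) σ↭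
  ; act-invol  = λ {σ} _ → reverse-involutive σ
  ; act-rotate = reverse-rotate
  ; act-occurs = λ P {σ} _ (a , b , c , d , p , h) →
      d , c , b , a , subst (_ ⊆_) (reverse-involutive σ) (Sublist.reverse⁺ p) , reverse-cyclicOccurrence P h
  }

complementPat : Pat → Pat
complementPat P1243 = P1243
complementPat P1324 = P1423
complementPat P1423 = P1324
complementPat P1342 = P1342

Chain-complement : ∀ {N x₁ x₂ x₃ x₄} → Chain x₁ x₂ x₃ x₄ → x₄ ≤ N →
                   Chain (N ∸ x₄) (N ∸ x₃) (N ∸ x₂) (N ∸ x₁)
Chain-complement (x₁<x₂ , x₂<x₃ , x₃<x₄) x₄≤N =
  ∸-monoʳ-< x₃<x₄ x₄≤N , ∸-monoʳ-< x₂<x₃ x₃≤N , ∸-monoʳ-< x₁<x₂ x₂≤N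
  where
  x₃≤N = ≤-trans (<⇒≤ x₃<x₄) x₄≤N
  x₂≤N = ≤-trans (<⇒≤ x₂<x₃) x₃≤N

complement-occurrence : ∀ P {N a b c d} → a ≤ N → b ≤ N → c ≤ N → d ≤ N → IsOccurrence P a b c d →
                        IsCyclicOccurrence (complementPat P) (N ∸ a) (N ∸ b) (N ∸ c) (N ∸ d)
complement-occurrence P1243 _ _ c≤N _ h = inj₂ (inj₂ (inj₁ (Chain-complement h c≤N)))
complement-occurrence P1324 _ _ _ d≤N h = inj₂ (inj₂ (inj₂ (Chain-complement h d≤N)))
complement-occurrence P1423 _ b≤N _ _ h = inj₂ (inj₁ (Chain-complement h b≤N))
complement-occurrence P1342 _ _ c≤N _ h = inj₂ (inj₂ (inj₁ (Chain-complement h c≤N)))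

complement-cyclicOccurrence : ∀ P {N a b c d} → a ≤ N → b ≤ N → c ≤ N → d ≤ N →
                              IsCyclicOccurrence P a b c d →
                              IsCyclicOccurrence (complementPat P) (N ∸ a) (N ∸ b) (N ∸ c) (N ∸ d)
complement-cyclicOccurrence P ha hb hc hd (inj₁ h) = complement-occurrence P ha hb hc hd h
complement-cyclicOccurrence P ha hb hc hd (inj₂ (inj₁ h)) =
  rot (rot (rot (complement-occurrence P hb hc hd ha h)))
  where rot = IsCyclicOccurrence-rotate
complement-cyclicOccurrence P ha hb hc hd (inj₂ (inj₂ (inj₁ h))) =
  rot (rot (complement-occurrence P hc hd ha hb h))
  where rot = IsCyclicOccurrence-rotate
complement-cyclicOccurrence P ha hb hc hd (inj₂ (inj₂ (inj₂ h))) =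
  IsCyclicOccurrence-rotate (complement-occurrence P hd ha hb hc h)

complement : ℕ → List ℕ → List ℕ
complement N = map (N ∸_)

complement-involutive : ∀ {N σ} → All (_≤ N) σ → complement N (complement N σ) ≡ σ
complement-involutive []           = refl
complement-involutive (x≤N ∷ σ≤N) = cong₂ _∷_ (m∸[m∸n]≡n x≤N) (complement-involutive σ≤N)

complement-≤ : ∀ N σ → All (_≤ N) (complement N σ)
complement-≤ N σ = Allₚ.map⁺ (All.universal (m∸n≤m N) σ)

complement-interval : ∀ m → complement (suc m) (interval 1 m) ↭ interval 1 m
complement-interval zero    = ↭-refl
complement-interval (suc m) = ↭-trans (↭-prep (suc m) (subst (_↭ interval 1 m) shift (complement-interval m)))
                                      (interval-∷-max 1 m)
  where
  shift : complement (suc m) (interval 1 m) ≡ complement (suc (suc m)) (interval 2 m)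
  shift = trans (map-∘ (interval 1 m)) (cong (complement (suc (suc m))) (sym (interval-suc 1 m)))

complementation : ∀ n → CyclicSymmetry n
complementation n = record
  { act        = complement (suc n)
  ; act-pat    = complementPat
  ; act-perm   = λ σ↭ →
      ↭interval⇒IsPerm (↭-trans (Permutation.map⁺ _ (IsPerm⇒↭interval σ↭)) (complement-interval n))
  ; act-invol  = λ σ↭ → complement-involutive (IsPerm⇒≤ σ↭)
  ; act-rotate = map-rotate (suc n ∸_)
  ; act-occurs = occurs
  }
  where
  occurs : ∀ P {σ} → IsPerm n σ → Occurs P (complement (suc n) σ) → Occurs (complementPat P) σ
  occurs P {σ} σ↭ (a , b , c , d , p , h) with Sublist.All-resp-⊆ p (complement-≤ (suc n) σ)
  ... | ha ∷ hb ∷ hc ∷ hd ∷ [] =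
    _ , _ , _ , _ , subst (_ ⊆_) (complement-involutive (IsPerm⇒≤ σ↭)) (Sublist.map⁺ (suc n ∸_) p) ,
    complement-cyclicOccurrence P ha hb hc hd h

AvCount-1342-1423 : ∀ n → AvCount (p1342 ∷ p1423 ∷ []) n (1 + (n ∸ 1) C 2)
AvCount-1342-1423 n = AvCount-transport (complementation n) {ps = P1324 ∷ P1342 ∷ []} {qs = P1342 ∷ P1423 ∷ []}
  (there (here refl) ∷ here refl ∷ []) (there (here refl) ∷ here refl ∷ []) (AvCount-1324-1342 n)

AvCount-1243-1423 : ∀ n → AvCount (p1243 ∷ p1423 ∷ []) n (1 + (n ∸ 1) C 2)
AvCount-1243-1423 n = AvCount-transport (reversal n) {ps = P1324 ∷ P1342 ∷ []} {qs = P1243 ∷ P1423 ∷ []}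
  (there (here refl) ∷ here refl ∷ []) (there (here refl) ∷ here refl ∷ []) (AvCount-1324-1342 n)

AvCount-1243-1324 : ∀ n → AvCount (p1243 ∷ p1324 ∷ []) n (1 + (n ∸ 1) C 2)
AvCount-1243-1324 n = AvCount-transport (reversal n) {ps = P1342 ∷ P1423 ∷ []} {qs = P1243 ∷ P1324 ∷ []}
  (here refl ∷ there (here refl) ∷ []) (here refl ∷ there (here refl) ∷ []) (AvCount-1342-1423 n)

mainTheorem6 :
    (∀ (n : ℕ) → Σ ℕ λ k →
        AvCount (p1243 ∷ p1324 ∷ []) n k
      × AvCount (p1243 ∷ p1423 ∷ []) n k
      × AvCount (p1324 ∷ p1342 ∷ []) n k
      × AvCount (p1342 ∷ p1423 ∷ []) n k)
    × (∀ (n : ℕ) → n ≥ 1 → AvCount (p1324 ∷ p1342 ∷ []) n (1 + ((n ∸ 1) C 2)))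
mainTheorem6 =
  (λ n → 1 + (n ∸ 1) C 2 , AvCount-1243-1324 n , AvCount-1243-1423 n , AvCount-1324-1342 n , AvCount-1342-1423 n) ,
  (λ n _ → AvCount-1324-1342 n)
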